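{- Let $p$ be a prime. If $\mathcal{C}$ is a linear $[n,k,d]_p$ code with $d_L(\mathcal{C})>\lfloor \mu_p(n-k)\rfloor$, then $\mathcal{C}$ is an MDS code, so $d=n-k+1$.
   Context: A linear $[n,k,d]_p$ code is a $k$-dimensional subspace of $\mathbb{Z}_p^n$ ($\mathbb{Z}_p=\mathbb{F}_p$) with minimum Hamming distance $d$; it is MDS if $d=n-k+1$. The Lee weight of $a\in\mathbb{Z}_p$ (as an integer in $\{0,\dots,p-1\}$) is $\min\{a,p-a\}$, the Lee weight of a vector is the sum over coordinates, and $d_L(\mathcal{C})$ is the minimum Lee weight of a nonzero codeword. $\mu_p$ is the average Lee weight of the nonzero elements of $\mathbb{Z}_p$: $\mu_2=1$ and $\mu_p=\frac{p+1}{4}$ for odd $p$. -}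

module Defs where

open import Data.Nat using (ℕ; zero; suc; _+_; _*_; _∸_; _≤_; _<_; NonZero; _⊔_; _⊓_)
open import Data.Nat.DivMod using (_mod_; _/_)
open import Data.Fin using (Fin; toℕ) renaming (zero to fzero; suc to fsuc)
open import Data.Product using (Σ; ∃; _×_; _,_)
open import Relation.Binary.PropositionalEquality using (_≡_)
open import Relation.Nullary using (¬_)

-- Elements of Z_p = F_p are represented by Fin p (integers 0..p-1).
-- Words of length n over Z_p.
Word : ℕ → ℕ → Set
Word p n = Fin n → Fin p

sumℕ : ∀ {m} → (Fin m → ℕ) → ℕ
sumℕ {zero}  f = 0
sumℕ {suc m} f = f fzero + sumℕ (λ i → f (fsuc i))

linComb : ∀ {p n k} .{{_ : NonZero p}} → (Fin k → Fin p) → (Fin k → Word p n) → Word p n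
linComb {p} c b j = (sumℕ (λ i → toℕ (c i) * toℕ (b i j))) mod p

IsZeroWord : ∀ {p n} → Word p n → Set
IsZeroWord w = ∀ j → toℕ (w j) ≡ 0

LinIndep : ∀ {p n k} .{{_ : NonZero p}} → (Fin k → Word p n) → Set
LinIndep b = ∀ c → IsZeroWord (linComb c b) → ∀ i → toℕ (c i) ≡ 0

IsLinearCode : ∀ p n .{{_ : NonZero p}} → (Word p n → Set) → ℕ → Set
IsLinearCode p n C k =
  Σ (Fin k → Word p n) λ b →
    LinIndep b × (∀ w → C w → ∃ λ c → ∀ j → w j ≡ linComb c b j)
               × (∀ c → C (linComb c b))

hammingWt : ∀ {p n} → Word p n → ℕ
hammingWt w = sumℕ (λ j → wt (toℕ (w j)))
  where
  wt : ℕ → ℕ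
  wt zero    = 0
  wt (suc _) = 1

leeWtElem : ∀ {p} → Fin p → ℕ
leeWtElem {p} a = toℕ a ⊓ (p ∸ toℕ a)

leeWt : ∀ {p n} → Word p n → ℕ
leeWt w = sumℕ (λ j → leeWtElem (w j))

-- d is the minimum weight (w.r.t. wt) of a nonzero codeword of C
-- (for a linear code, minimum distance = minimum nonzero weight).
IsMinWt : ∀ {p n} → (Word p n → ℕ) → (Word p n → Set) → ℕ → Set
IsMinWt wt C d =
  (∃ λ w → C w × ¬ IsZeroWord w × wt w ≡ d)
  × (∀ w → C w → ¬ IsZeroWord w → d ≤ wt w)

floorMuTimes : ℕ → ℕ → ℕ
floorMuTimes 2 m = m
floorMuTimes p m = ((p + 1) * m) / 4

{-# OPTIONS --safe #-}
module Submission where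

-- Let w be a codeword of minimum Hamming weight d. As a runs over F_p, every nonzero
-- coordinate of a·w runs over all of F_p, so the p - 1 nonzero multiples of w have total
-- Lee weight d·Σ_{x ∈ F_p} lee(x) = (p - 1)·μ_p·d, and one of them has Lee weight at most
-- ⌊μ_p d⌋. Hence d_L ≤ ⌊μ_p d⌋, and the hypothesis forces d > n - k. Conversely the
-- Singleton bound d ≤ n - k + 1 holds because k vectors with k - 1 coordinates are linearly
-- dependent modulo p (Gaussian elimination over ℤ), which yields a nonzero codeword
-- vanishing on k - 1 coordinates.

open import Defs
open import Data.Nat.Base as ℕ using (ℕ; zero; suc; NonZero; s≤s)
import Data.Nat.Properties as ℕ
import Data.Nat.Divisibility as ℕ
open import Data.Nat.Primality using (Prime; euclidsLemma; prime⇒nonTrivial; prime⇒irreducible)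
open import Data.Fin.Base using (Fin; toℕ; fromℕ<; inject≤; punchIn; punchOut) renaming (zero to fzero; suc to fsuc)
open import Data.Fin.Properties
  using (toℕ-fromℕ<; toℕ-injective; toℕ<n; toℕ-inject≤; all?; ¬∀⟶∃¬; punchIn-punchOut)
  renaming (_≟_ to _≟ᶠ_)
open import Data.Product.Base using (∃; _×_; _,_)
open import Data.Sum.Base using (_⊎_; inj₁; inj₂)
open import Function.Base using (_∘_)
open import Relation.Nullary.Negation.Core using (¬_; contradiction)
open import Relation.Nullary.Decidable.Core using (yes; no)
open import Relation.Binary.PropositionalEquality
open import Algebra.Properties.Semiring.Sum ℕ.+-*-semiring
  using (sum; sum-cong-≗; sum-replicate-zero; ∑-comm; ∑-distrib-+; *-distribˡ-sum; *-distribʳ-sum; sum-permute)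

-- Linear dependence modulo a prime

module _ {p : ℕ} .{{_ : NonZero p}} where

  open import Data.Integer.Base using (ℤ; +_; _+_; _*_; -_; _-_; 0ℤ; 1ℤ; ∣_∣; _%ℕ_; _/ℕ_)
  open import Data.Integer.DivMod using (a≡a%ℕn+[a/ℕn]*n; n%ℕd<d)
  import Data.Integer.Properties as ℤ
  open import Data.Integer.Divisibility.Signed
  open import Data.Integer.Tactic.RingSolver using (solve-∀)
  import Algebra.Properties.Semiring.Sum ℤ.+-*-semiring as ℤ∑

  private
    P : ℤ
    P = + p

  NontrivialRelation : ∀ {k m} → (Fin k → Fin m → ℤ) → (Fin k → ℤ) → Set
  NontrivialRelation v c = (∃ λ i → ¬ P ∣ c i) × (∀ j → P ∣ ℤ∑.sum (λ i → c i * v i j))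

  -- Row 0 clears column j₀ from the other rows; the rows are scaled by the pivot instead of
  -- dividing by it.
  eliminate : ∀ {k m} → (Fin (suc k) → Fin (suc m) → ℤ) → Fin (suc m) → Fin k → Fin m → ℤ
  eliminate v j₀ i j = v fzero j₀ * v (fsuc i) (punchIn j₀ j) - v (fsuc i) j₀ * v fzero (punchIn j₀ j)

  residue : ℤ → Fin p
  residue x = fromℕ< (n%ℕd<d x p)

  residue-≢0 : ∀ {x} → ¬ P ∣ x → toℕ (residue x) ≢ 0
  residue-≢0 {x} ∤x r≡0 = ∤x (divides (x /ℕ p) (begin
    x                          ≡⟨ a≡a%ℕn+[a/ℕn]*n x p ⟩
    + (x %ℕ p) + x /ℕ p * P    ≡⟨ cong (λ r → + r + x /ℕ p * P) (trans (sym (toℕ-fromℕ< (n%ℕd<d x p))) r≡0) ⟩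
    0ℤ + x /ℕ p * P            ≡⟨ ℤ.+-identityˡ _ ⟩
    x /ℕ p * P                 ∎))
    where open ≡-Reasoning

  pos-sum : ∀ {k} (f : Fin k → ℕ) → + sum f ≡ ℤ∑.sum (+_ ∘ f)
  pos-sum {zero}  f = refl
  pos-sum {suc k} f = trans (ℤ.pos-+ (f fzero) _) (cong (_+_ (+ f fzero)) (pos-sum (f ∘ fsuc)))

  residue-relation : ∀ {k} (c : Fin k → ℤ) (B : Fin k → ℕ) →
                     P ∣ ℤ∑.sum (λ i → c i * + B i) → sum (λ i → toℕ (residue (c i)) ℕ.* B i) ℕ.% p ≡ 0
  residue-relation c B P∣cB = ℕ.n∣m⇒m%n≡0 N p (∣⇒∣ᵤ (subst (P ∣_) (sym cast) P∣rB))
    where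
    N : ℕ
    N = sum (λ i → toℕ (residue (c i)) ℕ.* B i)
    r q : _ → ℤ
    r i = + toℕ (residue (c i))
    q i = c i /ℕ p
    split : ∀ i → c i * + B i ≡ r i * + B i + q i * + B i * P
    split i = trans (cong (_* + B i) (trans (a≡a%ℕn+[a/ℕn]*n (c i) p) (cong (λ z → + z + q i * P) (sym (toℕ-fromℕ< _)))))
                    (distrib (r i) (q i) P (+ B i))
      where
      distrib : ∀ r q P B → (r + q * P) * B ≡ r * B + q * B * P
      distrib = solve-∀
    decompose : ℤ∑.sum (λ i → c i * + B i) ≡ ℤ∑.sum (λ i → r i * + B i) + ℤ∑.sum (λ i → q i * + B i) * P
    decompose = begin
      ℤ∑.sum (λ i → c i * + B i)                                   ≡⟨ ℤ∑.sum-cong-≗ split ⟩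
      ℤ∑.sum (λ i → r i * + B i + q i * + B i * P)                 ≡⟨ ℤ∑.∑-distrib-+ (λ i → r i * + B i) (λ i → q i * + B i * P) ⟩
      ℤ∑.sum (λ i → r i * + B i) + ℤ∑.sum (λ i → q i * + B i * P)  ≡⟨ cong (_+_ (ℤ∑.sum (λ i → r i * + B i))) (ℤ∑.*-distribʳ-sum P (λ i → q i * + B i)) ⟨
      ℤ∑.sum (λ i → r i * + B i) + ℤ∑.sum (λ i → q i * + B i) * P  ∎
      where open ≡-Reasoning
    P∣rB : P ∣ ℤ∑.sum (λ i → r i * + B i)
    P∣rB = ∣m+n∣n⇒∣m (subst (P ∣_) decompose P∣cB) (∣n⇒∣m*n (ℤ∑.sum (λ i → q i * + B i)) ∣-refl)
    cast : + N ≡ ℤ∑.sum (λ i → r i * + B i)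
    cast = trans (pos-sum (λ i → toℕ (residue (c i)) ℕ.* B i)) (ℤ∑.sum-cong-≗ (λ i → ℤ.pos-* (toℕ (residue (c i))) (B i)))

  module _ (p-prime : Prime p) where

    private
      ∤1 : ¬ P ∣ 1ℤ
      ∤1 P∣1 = ℕ.<⇒≱ (ℕ.nonTrivial⇒n>1 p {{prime⇒nonTrivial p-prime}}) (ℕ.∣⇒≤ (∣⇒∣ᵤ P∣1))

      ∤-* : ∀ {a b} → ¬ P ∣ a → ¬ P ∣ b → ¬ P ∣ a * b
      ∤-* {a} {b} ∤a ∤b P∣ab with euclidsLemma ∣ a ∣ ∣ b ∣ p-prime (subst (p ℕ.∣_) (ℤ.abs-* a b) (∣⇒∣ᵤ P∣ab))
      ... | inj₁ p∣a = ∤a (∣ᵤ⇒∣ p∣a)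
      ... | inj₂ p∣b = ∤b (∣ᵤ⇒∣ p∣b)

    lift-relation : ∀ {k m} (v : Fin (suc k) → Fin (suc m) → ℤ) j₀ → ¬ P ∣ v fzero j₀ →
                    ∃ (NontrivialRelation (eliminate v j₀)) → ∃ (NontrivialRelation v)
    lift-relation {k} v j₀ ∤α (c′ , (i₁ , ∤c′ᵢ₁) , P∣c′w) = c , (fsuc i₁ , ∤-* ∤c′ᵢ₁ ∤α) , P∣cv
      where
      α : ℤ
      α = v fzero j₀
      β : Fin k → ℤ
      β i = v (fsuc i) j₀
      Σc′β : ℤ
      Σc′β = ℤ∑.sum (λ i → c′ i * β i)
      c : Fin (suc k) → ℤ
      c fzero    = - Σc′β
      c (fsuc i) = c′ i * α
      cv≡c′w : ∀ j → ℤ∑.sum (λ i → c i * v i j) ≡ ℤ∑.sum (λ i → c′ i * (α * v (fsuc i) j - β i * v fzero j))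
      cv≡c′w j = begin
        - Σc′β * v fzero j + Σc′αv
          ≡⟨ cong (_+ Σc′αv) (neg-swap Σc′β (v fzero j)) ⟩
        Σc′β * - v fzero j + Σc′αv
          ≡⟨ cong (_+ Σc′αv) (ℤ∑.*-distribʳ-sum (- v fzero j) (λ i → c′ i * β i)) ⟩
        ℤ∑.sum (λ i → c′ i * β i * - v fzero j) + Σc′αv
          ≡⟨ ℤ∑.∑-distrib-+ (λ i → c′ i * β i * - v fzero j) (λ i → c′ i * α * v (fsuc i) j) ⟨
        ℤ∑.sum (λ i → c′ i * β i * - v fzero j + c′ i * α * v (fsuc i) j)
          ≡⟨ ℤ∑.sum-cong-≗ (λ i → regroup (c′ i) α (β i) (v (fsuc i) j) (v fzero j)) ⟩
        ℤ∑.sum (λ i → c′ i * (α * v (fsuc i) j - β i * v fzero j))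
          ∎
        where
        open ≡-Reasoning
        Σc′αv = ℤ∑.sum (λ i → c′ i * α * v (fsuc i) j)
        neg-swap : ∀ x y → - x * y ≡ x * - y
        neg-swap = solve-∀
        regroup : ∀ c a b x y → c * b * - y + c * a * x ≡ c * (a * x - b * y)
        regroup = solve-∀
      P∣cv : ∀ j → P ∣ ℤ∑.sum (λ i → c i * v i j)
      P∣cv j with j₀ ≟ᶠ j
      ... | yes refl = subst (P ∣_) (sym (trans (cv≡c′w j₀) (trans (ℤ∑.sum-cong-≗ cancel) (ℤ∑.sum-replicate-zero k))))
                             (divides 0ℤ refl)
        where
        commute : ∀ c a b → c * (a * b - b * a) ≡ 0ℤ
        commute = solve-∀
        cancel : ∀ i → c′ i * (α * β i - β i * α) ≡ 0ℤ
        cancel i = commute (c′ i) α (β i)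
      ... | no j₀≢j = subst (P ∣_) (sym (cv≡c′w j))
                        (subst (λ j′ → P ∣ ℤ∑.sum (λ i → c′ i * (α * v (fsuc i) j′ - β i * v fzero j′)))
                               (punchIn-punchOut j₀≢j) (P∣c′w (punchOut j₀≢j)))

    ∃-nontrivial-relation : ∀ {m k} → m ℕ.< k → (v : Fin k → Fin m → ℤ) → ∃ (NontrivialRelation v)
    ∃-nontrivial-relation {zero}  {suc k} _ v = (λ _ → 1ℤ) , (fzero , ∤1) , λ ()
    ∃-nontrivial-relation {suc m} {suc k} (s≤s m<k) v with all? (λ j → P ∣? v fzero j)
    ... | yes P∣v₀ = e₀ , (fzero , ∤1) , λ j → subst (P ∣_) (sym (e₀v≡v₀ j)) (P∣v₀ j)
      where
      e₀ : Fin (suc k) → ℤ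
      e₀ fzero    = 1ℤ
      e₀ (fsuc _) = 0ℤ
      e₀v≡v₀ : ∀ j → ℤ∑.sum (λ i → e₀ i * v i j) ≡ v fzero j
      e₀v≡v₀ j = trans (cong₂ _+_ (ℤ.*-identityˡ (v fzero j)) (ℤ∑.sum-replicate-zero k)) (ℤ.+-identityʳ (v fzero j))
    ... | no ¬P∣v₀ with ¬∀⟶∃¬ (suc m) _ (λ j → P ∣? v fzero j) ¬P∣v₀
    ...   | j₀ , ∤α = lift-relation v j₀ ∤α (∃-nontrivial-relation m<k (eliminate v j₀))

    -- Opaque, so that with-abstractions over it do not run the elimination symbolically.
    opaque
      ∃-nontrivial-relation-mod : ∀ {m k} → m ℕ.< k → (v : Fin k → Fin m → ℕ) →
        ∃ λ (c : Fin k → Fin p) → (∃ λ i → toℕ (c i) ≢ 0) × (∀ j → sum (λ i → toℕ (c i) ℕ.* v i j) ℕ.% p ≡ 0)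
      ∃-nontrivial-relation-mod m<k v with ∃-nontrivial-relation m<k (λ i j → + v i j)
      ... | c , (i , ∤cᵢ) , P∣cv = residue ∘ c , (i , residue-≢0 ∤cᵢ) , λ j → residue-relation c (λ i → v i j) (P∣cv j)

open import Data.Nat.Base using (_+_; _*_; _∸_; _≤_; _<_; _⊓_; z≤n; _%_; nonTrivial⇒n>1; ≢-nonZero)
open import Data.Nat.Properties
open import Data.Nat.DivMod
open import Data.Nat.Divisibility using (_∣_; divides; n∣m⇒m%n≡0; m%n≡0⇒n∣m)
open import Data.Nat.Coprimality using (prime⇒coprime; coprime-Bézout)
open import Data.Nat.GCD using (module Bézout)
open import Data.Nat.Tactic.RingSolver using (solve-∀)
open import Data.Fin.Permutation using (permutation)

sumℕ≡sum : ∀ {m} (f : Fin m → ℕ) → sumℕ f ≡ sum f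
sumℕ≡sum {zero}  f = refl
sumℕ≡sum {suc m} f = cong (f fzero +_) (sumℕ≡sum (f ∘ fsuc))

sum-mono-≤ : ∀ {m} {f g : Fin m → ℕ} → (∀ i → f i ≤ g i) → sum f ≤ sum g
sum-mono-≤ {zero}  f≤g = z≤n
sum-mono-≤ {suc m} f≤g = +-mono-≤ (f≤g fzero) (sum-mono-≤ (f≤g ∘ fsuc))

sum-const : ∀ m x → sum {m} (λ _ → x) ≡ m * x
sum-const zero    x = refl
sum-const (suc m) x = cong (x +_) (sum-const m x)

∃-*-≤-sum : ∀ {m} (f : Fin (suc m) → ℕ) → ∃ λ i → suc m * f i ≤ sum f
∃-*-≤-sum {zero}  f = fzero , ≤-refl
∃-*-≤-sum {suc m} f with ∃-*-≤-sum (f ∘ fsuc)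
... | i , fᵢ≤avg with f fzero ≤? f (fsuc i)
...   | yes f₀≤fᵢ = fzero , +-monoʳ-≤ (f fzero) (≤-trans (*-monoʳ-≤ (suc m) f₀≤fᵢ) fᵢ≤avg)
...   | no  f₀≰fᵢ = fsuc i , +-mono-≤ (<⇒≤ (≰⇒> f₀≰fᵢ)) fᵢ≤avg

sum-split : ∀ m n (f : ℕ → ℕ) →
            sum {m + n} (f ∘ toℕ) ≡ sum {m} (f ∘ toℕ) + sum {n} (λ i → f (m + toℕ i))
sum-split zero    n f = refl
sum-split (suc m) n f = trans (cong (f 0 +_) (sum-split m n (f ∘ suc))) (sym (+-assoc (f 0) _ _))

sum-≤-∸ : ∀ {n} m (f : Fin n → ℕ) → (∀ j → f j ≤ 1) → (∀ j → toℕ j < m → f j ≡ 0) → sum f ≤ n ∸ m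
sum-≤-∸ {zero}  m       f f≤1 f≡0 = z≤n
sum-≤-∸ {suc n} zero    f f≤1 f≡0 = ≤-trans (sum-mono-≤ f≤1) (≤-reflexive (trans (sum-const (suc n) 1) (*-identityʳ _)))
sum-≤-∸ {suc n} (suc m) f f≤1 f≡0 rewrite f≡0 fzero (s≤s z≤n) =
  sum-≤-∸ m (f ∘ fsuc) (f≤1 ∘ fsuc) (λ j j<m → f≡0 (fsuc j) (s≤s j<m))

∃-≢0-*-≤-sum : ∀ {m} → 1 < m → (f : Fin m → ℕ) → ∃ λ i → toℕ i ≢ 0 × (m ∸ 1) * f i ≤ sum f
∃-≢0-*-≤-sum {suc zero}    (s≤s ()) f
∃-≢0-*-≤-sum {suc (suc m)} _ f with ∃-*-≤-sum (f ∘ fsuc)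
... | i , fᵢ≤sum = fsuc i , (λ ()) , ≤-trans fᵢ≤sum (m≤n+m _ (f fzero))

module _ {p : ℕ} .{{_ : NonZero p}} where

  %-cong-+ : ∀ {a a′ b b′} → a % p ≡ a′ % p → b % p ≡ b′ % p → (a + b) % p ≡ (a′ + b′) % p
  %-cong-+ {a} {a′} {b} {b′} a≡a′ b≡b′ = begin
    (a + b) % p              ≡⟨ %-distribˡ-+ a b p ⟩
    (a % p + b % p) % p      ≡⟨ cong₂ (λ x y → (x + y) % p) a≡a′ b≡b′ ⟩
    (a′ % p + b′ % p) % p    ≡⟨ %-distribˡ-+ a′ b′ p ⟨
    (a′ + b′) % p            ∎
    where open ≡-Reasoning

  %-cong-* : ∀ {a a′ b b′} → a % p ≡ a′ % p → b % p ≡ b′ % p → (a * b) % p ≡ (a′ * b′) % p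
  %-cong-* {a} {a′} {b} {b′} a≡a′ b≡b′ = begin
    (a * b) % p              ≡⟨ %-distribˡ-* a b p ⟩
    (a % p * (b % p)) % p    ≡⟨ cong₂ (λ x y → (x * y) % p) a≡a′ b≡b′ ⟩
    (a′ % p * (b′ % p)) % p  ≡⟨ %-distribˡ-* a′ b′ p ⟨
    (a′ * b′) % p            ∎
    where open ≡-Reasoning

  %-cong-sum : ∀ {m} {f g : Fin m → ℕ} → (∀ i → f i % p ≡ g i % p) → sum f % p ≡ sum g % p
  %-cong-sum {zero}  f≡g = refl
  %-cong-sum {suc m} f≡g = %-cong-+ (f≡g fzero) (%-cong-sum (f≡g ∘ fsuc))

  toℕ-mod : ∀ m → toℕ (m mod p) ≡ m % p
  toℕ-mod m = toℕ-fromℕ< (m%n<n m p)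

  toℕ-% : ∀ (a : Fin p) → toℕ a % p ≡ toℕ a
  toℕ-% a = m<n⇒m%n≡m (toℕ<n a)

  infixl 7 _·_

  _·_ : Fin p → Fin p → Fin p
  a · x = (toℕ a * toℕ x) mod p

  toℕ-·-% : ∀ a x → toℕ (a · x) % p ≡ (toℕ a * toℕ x) % p
  toℕ-·-% a x = trans (cong (_% p) (toℕ-mod _)) (m%n%n≡m%n _ p)

  toℕ-linComb : ∀ {n k} (c : Fin k → Fin p) (b : Fin k → Word p n) j →
                toℕ (linComb c b j) ≡ sum (λ i → toℕ (c i) * toℕ (b i j)) % p
  toℕ-linComb c b j = trans (toℕ-mod _) (cong (_% p) (sumℕ≡sum (λ i → toℕ (c i) * toℕ (b i j))))

  linComb-· : ∀ {n k} a (c : Fin k → Fin p) (b : Fin k → Word p n) j →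
              linComb (λ i → a · c i) b j ≡ a · linComb c b j
  linComb-· a c b j = toℕ-injective (begin
    toℕ (linComb (λ i → a · c i) b j)                      ≡⟨ toℕ-linComb (λ i → a · c i) b j ⟩
    sum (λ i → toℕ (a · c i) * B i) % p                    ≡⟨ %-cong-sum (λ i → %-cong-* (toℕ-·-% a (c i)) refl) ⟩
    sum (λ i → toℕ a * toℕ (c i) * B i) % p                ≡⟨ cong (_% p) (sum-cong-≗ (λ i → *-assoc (toℕ a) (toℕ (c i)) (B i))) ⟩
    sum (λ i → toℕ a * (toℕ (c i) * B i)) % p              ≡⟨ cong (_% p) (*-distribˡ-sum (toℕ a) (λ i → toℕ (c i) * B i)) ⟨
    toℕ a * sum (λ i → toℕ (c i) * B i) % p                ≡⟨ %-cong-* {toℕ a} refl (sym (m%n%n≡m%n (sum (λ i → toℕ (c i) * B i)) p)) ⟩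
    toℕ a * (sum (λ i → toℕ (c i) * B i) % p) % p          ≡⟨ cong (λ z → toℕ a * z % p) (toℕ-linComb c b j) ⟨
    toℕ a * toℕ (linComb c b j) % p                        ≡⟨ toℕ-mod (toℕ a * toℕ (linComb c b j)) ⟨
    toℕ (a · linComb c b j)                                ∎)
    where
    open ≡-Reasoning
    B : _ → ℕ
    B i = toℕ (b i j)

  ·-inverseʳ : ∀ {x y} → toℕ x * toℕ y % p ≡ 1 → ∀ a → a · x · y ≡ a
  ·-inverseʳ {x} {y} xy≡1 a = toℕ-injective (begin
    toℕ (a · x · y)                  ≡⟨ toℕ-mod _ ⟩
    toℕ (a · x) * toℕ y % p          ≡⟨ %-cong-* (toℕ-·-% a x) refl ⟩
    toℕ a * toℕ x * toℕ y % p        ≡⟨ cong (_% p) (*-assoc (toℕ a) _ _) ⟩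
    toℕ a * (toℕ x * toℕ y) % p      ≡⟨ %-cong-* {toℕ a} refl (trans xy≡1 (sym 1%p≡1)) ⟩
    toℕ a * 1 % p                    ≡⟨ cong (_% p) (*-identityʳ (toℕ a)) ⟩
    toℕ a % p                        ≡⟨ toℕ-% a ⟩
    toℕ a                            ∎)
    where
    open ≡-Reasoning
    1%p≡1 : 1 % p ≡ 1
    1%p≡1 = trans (cong (_% p) (sym xy≡1)) (trans (m%n%n≡m%n _ p) xy≡1)

  module _ (p-prime : Prime p) where

    private
      1<p : 1 < p
      1<p = nonTrivial⇒n>1 p {{prime⇒nonTrivial p-prime}}

      1%p≡1 : 1 % p ≡ 1
      1%p≡1 = m<n⇒m%n≡m 1<p

    ∣toℕ⇒≡0 : ∀ (a : Fin p) → p ∣ toℕ a → toℕ a ≡ 0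
    ∣toℕ⇒≡0 a p∣a = trans (sym (toℕ-% a)) (n∣m⇒m%n≡0 (toℕ a) p p∣a)

    ·-≢0 : ∀ {a x : Fin p} → toℕ a ≢ 0 → toℕ x ≢ 0 → toℕ (a · x) ≢ 0
    ·-≢0 {a} {x} a≢0 x≢0 ax≡0
      with euclidsLemma (toℕ a) (toℕ x) p-prime (m%n≡0⇒n∣m _ p (trans (sym (toℕ-mod _)) ax≡0))
    ... | inj₁ p∣a = a≢0 (∣toℕ⇒≡0 a p∣a)
    ... | inj₂ p∣x = x≢0 (∣toℕ⇒≡0 x p∣x)

    ∃-inverse : ∀ x → x ≢ 0 → x < p → ∃ λ y → x * y % p ≡ 1
    ∃-inverse x x≢0 x<p with coprime-Bézout (prime⇒coprime p-prime {{≢-nonZero x≢0}} x<p)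
    ... | Bézout.-+ u v 1+up≡vx = v , (begin
      x * v % p                 ≡⟨ cong (_% p) (trans (*-comm x v) (sym 1+up≡vx)) ⟩
      (1 + u * p) % p           ≡⟨ [m+kn]%n≡m%n 1 u p ⟩
      1 % p                     ≡⟨ 1%p≡1 ⟩
      1                         ∎)
      where open ≡-Reasoning
    -- Here v x ≡ -1 (mod p), so v (p - 1) is the inverse.
    ... | Bézout.+- u v 1+vx≡up = v * (p ∸ 1) , (begin
      x * (v * (p ∸ 1)) % p                  ≡⟨ [m+kn]%n≡m%n _ u p ⟨
      (x * (v * (p ∸ 1)) + u * p) % p        ≡⟨ cong (λ z → (x * (v * (p ∸ 1)) + z) % p) 1+vx≡up ⟨
      (x * (v * (p ∸ 1)) + (1 + v * x)) % p  ≡⟨ cong (_% p) (rearrange x v (p ∸ 1)) ⟩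
      (1 + v * x * (p ∸ 1 + 1)) % p          ≡⟨ cong (λ z → (1 + v * x * z) % p) (m∸n+n≡m (<⇒≤ 1<p)) ⟩
      (1 + v * x * p) % p                    ≡⟨ [m+kn]%n≡m%n 1 (v * x) p ⟩
      1 % p                                  ≡⟨ 1%p≡1 ⟩
      1                                      ∎)
      where
      open ≡-Reasoning
      rearrange : ∀ x v q → x * (v * q) + (1 + v * x) ≡ 1 + v * x * (q + 1)
      rearrange = solve-∀

    sum-·-≢0 : ∀ {x : Fin p} → toℕ x ≢ 0 → (f : Fin p → ℕ) → sum (λ a → f (a · x)) ≡ sum f
    sum-·-≢0 {x} x≢0 f with ∃-inverse (toℕ x) x≢0 (toℕ<n x)
    ... | y , xy≡1 = sym (sum-permute f (permutation (_· x) (_· y′) (·-inverseʳ y′x≡1) (·-inverseʳ xy′≡1)))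
      where
      y′ : Fin p
      y′ = y mod p
      xy′≡1 : toℕ x * toℕ y′ % p ≡ 1
      xy′≡1 = trans (%-cong-* {a = toℕ x} refl (trans (cong (_% p) (toℕ-mod y)) (m%n%n≡m%n y p))) xy≡1
      y′x≡1 : toℕ y′ * toℕ x % p ≡ 1
      y′x≡1 = trans (cong (_% p) (*-comm (toℕ y′) (toℕ x))) xy′≡1

-- Hamming and Lee weights

-- The coordinate weight used by Defs.hammingWt, which is local to its where block.
hammingWtElem : ∀ {p} → Fin p → ℕ
hammingWtElem fzero    = 0
hammingWtElem (fsuc _) = 1

hammingWt≡sum : ∀ {p n} (w : Word p n) → hammingWt w ≡ sum (hammingWtElem ∘ w)
hammingWt≡sum {n = zero}  w = refl
hammingWt≡sum {n = suc n} w with w fzero | hammingWt≡sum (w ∘ fsuc)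
... | fzero  | ih = ih
... | fsuc _ | ih = cong suc ih

hammingWtElem≤1 : ∀ {p} (x : Fin p) → hammingWtElem x ≤ 1
hammingWtElem≤1 fzero    = z≤n
hammingWtElem≤1 (fsuc _) = s≤s z≤n

hammingWtElem-≡0 : ∀ {p} (x : Fin p) → toℕ x ≡ 0 → hammingWtElem x ≡ 0
hammingWtElem-≡0 fzero _ = refl

hammingWt-≤-∸ : ∀ {p n} m (w : Word p n) → (∀ j → toℕ j < m → toℕ (w j) ≡ 0) → hammingWt w ≤ n ∸ m
hammingWt-≤-∸ m w w≡0 = subst (_≤ _) (sym (hammingWt≡sum w))
  (sum-≤-∸ m (hammingWtElem ∘ w) (hammingWtElem≤1 ∘ w) (λ j j<m → hammingWtElem-≡0 (w j) (w≡0 j j<m)))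

leeWt-cong : ∀ {p n} {u v : Word p n} → (∀ j → u j ≡ v j) → leeWt u ≡ leeWt v
leeWt-cong {u = u} {v} u≗v = begin
  leeWt u                ≡⟨ sumℕ≡sum (leeWtElem ∘ u) ⟩
  sum (leeWtElem ∘ u)    ≡⟨ sum-cong-≗ (cong leeWtElem ∘ u≗v) ⟩
  sum (leeWtElem ∘ v)    ≡⟨ sumℕ≡sum (leeWtElem ∘ v) ⟨
  leeWt v                ∎
  where open ≡-Reasoning

-- leeSum p = (p - 1) μ_p: it is 1 for p = 2 and r (r + 1) for p = 2 r + 1.
leeSum : ℕ → ℕ
leeSum p = sum (λ (a : Fin p) → leeWtElem a)

module _ {p : ℕ} .{{_ : NonZero p}} (p-prime : Prime p) where

  sum-leeWtElem-· : ∀ (x : Fin p) → sum (λ a → leeWtElem (a · x)) ≡ hammingWtElem x * leeSum p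
  sum-leeWtElem-· fzero = begin
    sum (λ a → leeWtElem (a · fzero))  ≡⟨ sum-cong-≗ (λ a → cong (λ t → t ⊓ (p ∸ t)) (a·0≡0 a)) ⟩
    sum {p} (λ _ → 0)                  ≡⟨ sum-replicate-zero p ⟩
    0                                  ∎
    where
    open ≡-Reasoning
    a·0≡0 : ∀ a → toℕ (a · fzero) ≡ 0
    a·0≡0 a = trans (toℕ-mod (toℕ a * 0)) (trans (cong (_% p) (*-zeroʳ (toℕ a))) (m*n%n≡0 0 p))
  sum-leeWtElem-· (fsuc y) = trans (sum-·-≢0 p-prime {x = fsuc y} (λ ()) leeWtElem) (sym (+-identityʳ (leeSum p)))

  sum-leeWt-· : ∀ {n} (w : Word p n) → sum (λ a → leeWt (λ j → a · w j)) ≡ hammingWt w * leeSum p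
  sum-leeWt-· w = begin
    sum (λ a → leeWt (λ j → a · w j))                ≡⟨ sum-cong-≗ (λ a → sumℕ≡sum (λ j → leeWtElem (a · w j))) ⟩
    sum (λ a → sum (λ j → leeWtElem (a · w j)))      ≡⟨ ∑-comm (λ a j → leeWtElem (a · w j)) ⟩
    sum (λ j → sum (λ a → leeWtElem (a · w j)))      ≡⟨ sum-cong-≗ (sum-leeWtElem-· ∘ w) ⟩
    sum (λ j → hammingWtElem (w j) * leeSum p)       ≡⟨ *-distribʳ-sum (leeSum p) (hammingWtElem ∘ w) ⟨
    sum (hammingWtElem ∘ w) * leeSum p               ≡⟨ cong (_* leeSum p) (hammingWt≡sum w) ⟨
    hammingWt w * leeSum p                           ∎
    where open ≡-Reasoning

  ∃-leeWt-·-≤-average : ∀ {n} (w : Word p n) →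
                        ∃ λ a → toℕ a ≢ 0 × (p ∸ 1) * leeWt (λ j → a · w j) ≤ hammingWt w * leeSum p
  ∃-leeWt-·-≤-average w
    with ∃-≢0-*-≤-sum (nonTrivial⇒n>1 p {{prime⇒nonTrivial p-prime}}) (λ a → leeWt (λ j → a · w j))
  ... | a , a≢0 , bound = a , a≢0 , ≤-trans bound (≤-reflexive (sum-leeWt-· w))

-- The constant μ_p

leeSum-odd : ∀ r → leeSum (suc (r + r)) ≡ r * suc r
leeSum-odd r = begin
  leeSum (suc r + r)                                         ≡⟨ sum-split (suc r) r lee ⟩
  sum {suc r} (lee ∘ toℕ) + sum {r} (λ i → lee (suc r + toℕ i))
    ≡⟨ cong₂ _+_ (sum-cong-≗ (lee-≤ ∘ toℕ<n)) (sum-cong-≗ (lee-> ∘ toℕ<n)) ⟩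
  sum {suc r} toℕ + sum {r} (λ i → r ∸ toℕ i)                ≡⟨ cong (_+ sum {r} (λ i → r ∸ toℕ i)) (∑-distrib-+ {r} (λ _ → 1) toℕ) ⟩
  sum {r} (λ _ → 1) + sum {r} toℕ + sum {r} (λ i → r ∸ toℕ i) ≡⟨ +-assoc (sum {r} (λ _ → 1)) _ _ ⟩
  sum {r} (λ _ → 1) + (sum {r} toℕ + sum {r} (λ i → r ∸ toℕ i))
    ≡⟨ cong₂ _+_ (trans (sum-const r 1) (*-identityʳ r)) (sym (∑-distrib-+ {r} toℕ (λ i → r ∸ toℕ i))) ⟩
  r + sum {r} (λ i → toℕ i + (r ∸ toℕ i))                     ≡⟨ cong (r +_) (sum-cong-≗ {r} (λ i → m+[n∸m]≡n (<⇒≤ (toℕ<n i)))) ⟩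
  r + sum {r} (λ _ → r)                                      ≡⟨ cong (r +_) (sum-const r r) ⟩
  r + r * r                                                  ≡⟨ *-suc r r ⟨
  r * suc r                                                  ∎
  where
  open ≡-Reasoning
  lee : ℕ → ℕ
  lee t = t ⊓ (suc (r + r) ∸ t)
  lee-≤ : ∀ {t} → t < suc r → lee t ≡ t
  lee-≤ {t} (s≤s t≤r) = m≤n⇒m⊓n≡m (m+n≤o⇒m≤o∸n t (≤-trans (+-mono-≤ t≤r t≤r) (n≤1+n (r + r))))
  lee-> : ∀ {i} → i < r → lee (suc r + i) ≡ r ∸ i
  lee-> {i} i<r = trans (cong ((suc r + i) ⊓_) ([m+n]∸[m+o]≡n∸o r r i))
                        (m≥n⇒m⊓n≡n (≤-trans (m∸n≤m r i) (≤-trans (n≤1+n r) (m≤m+n (suc r) i))))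

floorMuTimes-monoʳ-≤ : ∀ p {x y} → x ≤ y → floorMuTimes p x ≤ floorMuTimes p y
floorMuTimes-monoʳ-≤ 2                   x≤y = x≤y
floorMuTimes-monoʳ-≤ 0                   x≤y = /-monoˡ-≤ 4 (*-monoʳ-≤ 1 x≤y)
floorMuTimes-monoʳ-≤ 1                   x≤y = /-monoˡ-≤ 4 (*-monoʳ-≤ 2 x≤y)
floorMuTimes-monoʳ-≤ (suc (suc (suc p))) x≤y = /-monoˡ-≤ 4 (*-monoʳ-≤ (suc (suc (suc p)) + 1) x≤y)

parity : ∀ n → ∃ λ r → n ≡ r + r ⊎ n ≡ suc (r + r)
parity zero    = 0 , inj₁ refl
parity (suc n) with parity n
... | r , inj₁ n≡r+r   = r , inj₂ (cong suc n≡r+r)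
... | r , inj₂ n≡1+r+r = suc r , inj₁ (cong suc (trans n≡1+r+r (sym (+-suc r r))))

prime⇒≡2⊎odd : ∀ {p} → Prime p → p ≡ 2 ⊎ ∃ λ r → p ≡ suc (suc r + suc r)
prime⇒≡2⊎odd {p} p-prime with parity p
... | r , inj₁ refl with prime⇒irreducible p-prime (divides r (trans (cong (r +_) (sym (+-identityʳ r))) (*-comm 2 r)))
...   | inj₂ 2≡r+r = inj₁ (sym 2≡r+r)
prime⇒≡2⊎odd p-prime | zero  , inj₂ refl = contradiction (nonTrivial⇒n>1 1 {{prime⇒nonTrivial p-prime}}) (<-irrefl refl)
prime⇒≡2⊎odd p-prime | suc r , inj₂ refl = inj₂ (r , refl)

m*n≤o⇒m≤o/n : ∀ m n {o} .{{_ : NonZero n}} → m * n ≤ o → m ≤ o / n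
m*n≤o⇒m≤o/n m n {o} mn≤o = subst (_≤ o / n) (m*n/n≡m m n) (/-monoˡ-≤ n mn≤o)

floorMuTimes-odd : ∀ r d → floorMuTimes (suc (suc r + suc r)) d ≡ (suc (suc r + suc r) + 1) * d / 4
floorMuTimes-odd r d rewrite +-suc r r = refl

≤-floorMuTimes : ∀ {p L d} → Prime p → (p ∸ 1) * L ≤ d * leeSum p → L ≤ floorMuTimes p d
≤-floorMuTimes {p} {L} {d} p-prime bound with prime⇒≡2⊎odd p-prime
... | inj₁ refl = subst₂ _≤_ (+-identityʳ L) (*-identityʳ d) bound
... | inj₂ (r , refl) = subst (L ≤_) (sym (floorMuTimes-odd r d)) (m*n≤o⇒m≤o/n L 4 4L≤[p+1]d)
  where
  s = suc r
  2L≤d[s+1] : 2 * L ≤ d * suc s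
  2L≤d[s+1] = *-cancelˡ-≤ s (subst₂ _≤_ (lhs s L) (trans (cong (d *_) (leeSum-odd s)) (rhs s d)) bound)
    where
    lhs : ∀ s L → (s + s) * L ≡ s * (2 * L)
    lhs = solve-∀
    rhs : ∀ s d → d * (s * suc s) ≡ s * (d * suc s)
    rhs = solve-∀
  4L≤[p+1]d : L * 4 ≤ (suc (s + s) + 1) * d
  4L≤[p+1]d = subst₂ _≤_ (lhs L) (rhs s d) (*-monoʳ-≤ 2 2L≤d[s+1])
    where
    lhs : ∀ L → 2 * (2 * L) ≡ L * 4
    lhs = solve-∀
    rhs : ∀ s d → 2 * (d * suc s) ≡ (suc (s + s) + 1) * d
    rhs = solve-∀

-- The Singleton bound

m∸n≤m∸[1+n]+1 : ∀ m n → m ∸ n ≤ m ∸ suc n + 1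
m∸n≤m∸[1+n]+1 zero    zero    = z≤n
m∸n≤m∸[1+n]+1 zero    (suc n) = z≤n
m∸n≤m∸[1+n]+1 (suc m) zero    = ≤-reflexive (+-comm 1 m)
m∸n≤m∸[1+n]+1 (suc m) (suc n) = m∸n≤m∸[1+n]+1 m n

∃-nontrivial-linComb-vanishing : ∀ {p m k n} .{{_ : NonZero p}} → Prime p →
  (b : Fin k → Word p n) (e : Fin m → Fin n) → m < k →
  ∃ λ c → (∃ λ i → toℕ (c i) ≢ 0) × (∀ j → toℕ (linComb c b (e j)) ≡ 0)
∃-nontrivial-linComb-vanishing p-prime b e m<k with ∃-nontrivial-relation-mod p-prime m<k (λ i j → toℕ (b i (e j)))
... | c , nontrivial , relation = c , nontrivial , λ j → trans (toℕ-linComb c b (e j)) (relation j)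

singleton-bound : ∀ {p n k d} .{{_ : NonZero p}} {C : Word p n → Set} → Prime p →
                  IsLinearCode p n C k → IsMinWt hammingWt C d → d ≤ n ∸ k + 1
singleton-bound {k = zero} _ _ ((w , _ , _ , refl) , _) =
  ≤-trans (hammingWt-≤-∸ 0 w (λ _ ())) (m≤m+n _ 1)
singleton-bound {p} {n} {suc k} p-prime (b , independent , _ , closed) (_ , minimal)
  -- Vanishing on k ⊓ n < suc k coordinates covers the case k ≥ n without a separate argument.
  with ∃-nontrivial-linComb-vanishing p-prime b (λ j → inject≤ j (m⊓n≤n k n)) (s≤s (m⊓n≤m k n))
... | c , (i , cᵢ≢0) , vanishes =
  ≤-trans (minimal u (closed c) u≢0) (≤-trans (hammingWt-≤-∸ k u vanishes-below-k) (m∸n≤m∸[1+n]+1 n k))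
  where
  u : Word p n
  u = linComb c b
  u≢0 : ¬ IsZeroWord u
  u≢0 u≡0 = cᵢ≢0 (independent c u≡0 i)
  vanishes-below-k : ∀ j → toℕ j < k → toℕ (u j) ≡ 0
  vanishes-below-k j j<k = subst (λ j → toℕ (u j) ≡ 0) inject≤-j′≡j (vanishes j′)
    where
    j<k⊓n = ⊓-pres-m< j<k (toℕ<n j)
    j′ = fromℕ< j<k⊓n
    inject≤-j′≡j : inject≤ j′ (m⊓n≤n k n) ≡ j
    inject≤-j′≡j = toℕ-injective (trans (toℕ-inject≤ j′ _) (toℕ-fromℕ< j<k⊓n))

∃-low-leeWt-multiple : ∀ {p n k} .{{_ : NonZero p}} {C : Word p n → Set} → Prime p → IsLinearCode p n C k →
  ∀ {w} → C w → ¬ IsZeroWord w → ∃ λ u → C u × ¬ IsZeroWord u × leeWt u ≤ floorMuTimes p (hammingWt w)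
∃-low-leeWt-multiple {p} {n} p-prime (b , _ , spans , closed) {w} w∈C w≢0
  with spans w w∈C | ∃-leeWt-·-≤-average p-prime w
... | c , w≡cb | a , a≢0 , bound = u , closed (λ i → a · c i) , u≢0 , leeWt-u≤
  where
  u : Word p n
  u = linComb (λ i → a · c i) b
  u≡a·w : ∀ j → u j ≡ a · w j
  u≡a·w j = trans (linComb-· a c b j) (cong (a ·_) (sym (w≡cb j)))
  u≢0 : ¬ IsZeroWord u
  u≢0 u≡0 with ¬∀⟶∃¬ n _ (λ j → toℕ (w j) ≟ 0) w≢0
  ... | j , wⱼ≢0 = ·-≢0 p-prime a≢0 wⱼ≢0 (trans (cong toℕ (sym (u≡a·w j))) (u≡0 j))
  leeWt-u≤ : leeWt u ≤ floorMuTimes p (hammingWt w)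
  leeWt-u≤ = ≤-floorMuTimes p-prime (subst (λ x → (p ∸ 1) * x ≤ _) (sym (leeWt-cong u≡a·w)) bound)

lemma12 : (p : ℕ) .{{_ : NonZero p}} → Prime p →
          (n k d dL : ℕ) (C : Word p n → Set) →
          IsLinearCode p n C k →
          IsMinWt hammingWt C d →
          IsMinWt leeWt C dL →
          floorMuTimes p (n ∸ k) < dL →
          d ≡ n ∸ k + 1
lemma12 p p-prime n k d dL C code d-min@((w , w∈C , w≢0 , refl) , _) (_ , dL-minimal) μ[n-k]<dL
  with ∃-low-leeWt-multiple p-prime code w∈C w≢0
... | u , u∈C , u≢0 , leeWt-u≤μd =
  ≤-antisym (singleton-bound p-prime code d-min) (subst (_≤ hammingWt w) (+-comm 1 (n ∸ k)) (≰⇒> d≰n-k))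
  where
  d≰n-k : ¬ hammingWt w ≤ n ∸ k
  d≰n-k d≤n-k = <⇒≱ μ[n-k]<dL
    (≤-trans (dL-minimal u u∈C u≢0) (≤-trans leeWt-u≤μd (floorMuTimes-monoʳ-≤ p d≤n-k)))
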